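{- Let $n\geq 1$ be an integer and let $G$ be a graph on $N\geq 2n+2$ vertices. Define $L(G)=\{v\in V(G): d(v)\geq 2n+1\}$, $M(G)=\{v\in V(G): n+1\leq d(v)\leq 2n\}$ and $S(G)=\{v\in V(G): d(v)\leq n\}$. If $L(G)\neq\emptyset$, then either $G$ contains (as a subgraph) every double star on $2n+2$ vertices, or $$\sum_{v\in L(G)} d(v)=e(L(G),S(G)),$$ in particular $S(G)\neq\emptyset$.
   Context: $d(v)$ denotes the degree of $v$ in $G$, and $e(A,B)$ denotes the number of edges of $G$ with one endpoint in $A$ and the other in $B$ (for disjoint vertex sets $A,B$). A double star is a tree obtained by joining by an edge the centers of two vertex-disjoint stars; $S_{k,l}$ denotes the double star whose two stars have $k$ and $l$ leaves, so it has $k+l+2$ vertices. -}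

module Defs where

open import Data.Nat using (ℕ; zero; suc; _+_; _*_; _≤_; _<_; _≤ᵇ_)
open import Data.Bool using (Bool; true; false; _∧_)
open import Data.Fin using (Fin)
open import Data.List using (List; length; filter; map; allFin; concatMap)
open import Data.Nat.ListAction using (sum)
open import Data.Product using (Σ; _×_; _,_)
open import Relation.Binary.PropositionalEquality using (_≡_)
open import Relation.Nullary.Decidable using (Dec)
open import Data.Bool.Properties using (T?)
open import Function.Definitions using (Injective)

record Graph (N : ℕ) : Set where
  field
    adj    : Fin N → Fin N → Bool
    sym    : ∀ u v → adj u v ≡ adj v u
    irrefl : ∀ v → adj v v ≡ false
open Graph public

deg : ∀ {N} → Graph N → Fin N → ℕ
deg {N} G v = length (filter (λ w → T? (adj G v w)) (allFin N))

inL inM inS : ∀ {N} → ℕ → Graph N → Fin N → Bool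
inL n G v = suc (2 * n) ≤ᵇ deg G v
inM n G v = (suc n ≤ᵇ deg G v) ∧ (deg G v ≤ᵇ 2 * n)
inS n G v = deg G v ≤ᵇ n

sumDegL : ∀ {N} → ℕ → Graph N → ℕ
sumDegL {N} n G = sum (map (deg G) (filter (λ v → T? (inL n G v)) (allFin N)))

-- e(A,B) for A, B given by Boolean predicates: number of edges uv with
-- u ∈ A, v ∈ B (for disjoint A, B each such edge is counted once as the
-- ordered pair (u,v) with u ∈ A, v ∈ B).
eBetween : ∀ {N} → Graph N → (Fin N → Bool) → (Fin N → Bool) → ℕ
eBetween {N} G A B =
  length (filter (λ p → T? (A (Data.Product.proj₁ p) ∧ B (Data.Product.proj₂ p)
                              ∧ adj G (Data.Product.proj₁ p) (Data.Product.proj₂ p)))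
                 (concatMap (λ u → map (λ v → (u , v)) (allFin N)) (allFin N)))

data DSVertex (k l : ℕ) : Set where
  centre₁ centre₂ : DSVertex k l
  leaf₁ : Fin k → DSVertex k l
  leaf₂ : Fin l → DSVertex k l

data DSEdge {k l : ℕ} : DSVertex k l → DSVertex k l → Set where
  cc  : DSEdge centre₁ centre₂
  cc' : DSEdge centre₂ centre₁
  c₁l : ∀ i → DSEdge centre₁ (leaf₁ i)
  lc₁ : ∀ i → DSEdge (leaf₁ i) centre₁
  c₂l : ∀ j → DSEdge centre₂ (leaf₂ j)
  lc₂ : ∀ j → DSEdge (leaf₂ j) centre₂

ContainsDoubleStar : ∀ {N} → Graph N → ℕ → ℕ → Set
ContainsDoubleStar {N} G k l =
  Σ (DSVertex k l → Fin N) λ f →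
    Injective _≡_ _≡_ f × (∀ x y → DSEdge x y → adj G (f x) (f y) ≡ true)

ContainsAllDoubleStars : ∀ {N} → Graph N → ℕ → Set
ContainsAllDoubleStars G n =
  ∀ k l → 1 ≤ k → 1 ≤ l → k + l + 2 ≡ 2 * n + 2 → ContainsDoubleStar G k l

{-# OPTIONS --safe #-}
-- If some u ∈ L(G) has a neighbour w ∉ S(G), every S_{k,l} with k + l = 2n embeds
-- with centres u and w: after swapping the two stars l ≤ n, so w has l neighbours
-- other than u, and u, having at least k + l + 1 neighbours, still has k of them
-- avoiding w and those l leaves. Otherwise every edge at a vertex v ∈ L(G) ends in
-- S(G), so v contributes exactly d(v) to e(L(G), S(G)), and its neighbours lie in S(G).
module Submission where

open import Defs hiding (sym)
open import Data.Nat using (ℕ; suc; _+_; _*_; _≤_; _<_; _≤ᵇ_; s≤s; z≤n)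
open import Data.Nat.Properties
open import Data.Nat.ListAction using (sum)
open import Data.Bool using (Bool; true; false; _∧_; _∨_; not; if_then_else_; T)
open import Data.Bool.Properties using (T?; T-≡; T-∧; ∧-zeroʳ; ¬-not) renaming (_≟_ to _≟ᵇ_)
open import Data.Fin using (Fin; inject≤) renaming (_≟_ to _≟ᶠ_)
open import Data.Fin.Properties using (any?; inject≤-injective)
open import Data.List using (List; []; _∷_; length; filter; map; allFin; concatMap; tabulate; lookup; _++_)
open import Data.List.Properties using (map-cong; length-tabulate; length-++; filter-++; filter-none)
open import Data.List.Membership.Propositional using (_∈_; _∉_)
open import Data.List.Membership.Propositional.Properties using (∈-lookup; ∈-filter⁻; ∈-tabulate⁺)
import Data.List.Relation.Unary.All as All
open import Data.List.Relation.Unary.All using (All)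
open import Data.List.Relation.Unary.AllPairs using ([]; _∷_)
open import Data.List.Relation.Unary.Any using (here; there)
open import Data.List.Relation.Unary.Unique.Propositional using (Unique)
open import Data.List.Relation.Unary.Unique.Propositional.Properties using (filter⁺; allFin⁺)
open import Data.Product using (Σ; Σ-syntax; _×_; _,_; proj₁; proj₂)
open import Data.Sum using (_⊎_; inj₁; inj₂)
open import Function using (_∘_; id)
open import Function.Bundles using (Equivalence)
open import Function.Definitions using (Injective)
open import Relation.Binary.Definitions using (DecidableEquality)
open import Relation.Binary.PropositionalEquality
open import Relation.Nullary using (¬_; yes; no; does; contradiction)
open import Relation.Nullary.Decidable using (dec-true; dec-false; _×-dec_)

open Equivalence using (to)

private
  variable
    A B : Set

count : (A → Bool) → List A → ℕ
count p xs = length (filter (λ x → T? (p x)) xs)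

count-cong : ∀ {p q : A → Bool} → (∀ x → p x ≡ q x) → ∀ xs → count p xs ≡ count q xs
count-cong p≗q []       = refl
count-cong {p = p} {q = q} p≗q (x ∷ xs) with p x | q x | p≗q x
... | true  | .true  | refl = cong suc (count-cong p≗q xs)
... | false | .false | refl = count-cong p≗q xs

count-none : ∀ {p : A → Bool} {xs} → All (λ x → ¬ T (p x)) xs → count p xs ≡ 0
count-none {p = p} none = cong length (filter-none (λ x → T? (p x)) none)

count-false : ∀ (xs : List A) → count (λ _ → false) xs ≡ 0
count-false xs = count-none {p = λ _ → false} (All.universal (λ _ → id) xs)

count-split : ∀ (p q : A → Bool) xs → count p xs ≤ count (λ x → p x ∧ not (q x)) xs + count q xs
count-split p q []       = z≤n
count-split p q (x ∷ xs) with p x | q x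
... | true  | true  = ≤-trans (s≤s (count-split p q xs)) (≤-reflexive (sym (+-suc _ _)))
... | true  | false = s≤s (count-split p q xs)
... | false | true  = ≤-trans (count-split p q xs) (≤-trans (n≤1+n _) (≤-reflexive (sym (+-suc _ _))))
... | false | false = count-split p q xs

count-∨ : ∀ (p q : A → Bool) xs → count (λ x → p x ∨ q x) xs ≤ count p xs + count q xs
count-∨ p q []       = z≤n
count-∨ p q (x ∷ xs) with p x | q x
... | true  | true  = s≤s (≤-trans (count-∨ p q xs) (≤-trans (n≤1+n _) (≤-reflexive (sym (+-suc _ _)))))
... | true  | false = s≤s (count-∨ p q xs)
... | false | true  = ≤-trans (s≤s (count-∨ p q xs)) (≤-reflexive (sym (+-suc _ _)))
... | false | false = count-∨ p q xs

count-++ : ∀ (p : A → Bool) xs ys → count p (xs ++ ys) ≡ count p xs + count p ys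
count-++ p xs ys = trans (cong length (filter-++ (λ x → T? (p x)) xs ys)) (length-++ (filter _ xs))

count-map : ∀ (p : B → Bool) (f : A → B) xs → count p (map f xs) ≡ count (p ∘ f) xs
count-map p f []       = refl
count-map p f (x ∷ xs) with p (f x)
... | true  = cong suc (count-map p f xs)
... | false = count-map p f xs

count-concatMap : ∀ (p : B → Bool) (f : A → List B) xs →
                  count p (concatMap f xs) ≡ sum (map (count p ∘ f) xs)
count-concatMap p f []       = refl
count-concatMap p f (x ∷ xs) =
  trans (count-++ p (f x) (concatMap f xs)) (cong (count p (f x) +_) (count-concatMap p f xs))

sum-map-filter : ∀ (p : A → Bool) (g : A → ℕ) xs →
                 sum (map g (filter (λ x → T? (p x)) xs)) ≡ sum (map (λ x → if p x then g x else 0) xs)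
sum-map-filter p g []       = refl
sum-map-filter p g (x ∷ xs) with p x
... | true  = cong (g x +_) (sum-map-filter p g xs)
... | false = sum-map-filter p g xs

lookup-injective : ∀ {xs : List A} → Unique xs → ∀ {i j} → lookup xs i ≡ lookup xs j → i ≡ j
lookup-injective (x∉xs ∷ u) {Fin.zero}  {Fin.zero}  e = refl
lookup-injective (x∉xs ∷ u) {Fin.zero}  {Fin.suc j} e = contradiction e (All.lookup x∉xs (∈-lookup j))
lookup-injective (x∉xs ∷ u) {Fin.suc i} {Fin.zero}  e = contradiction (sym e) (All.lookup x∉xs (∈-lookup i))
lookup-injective (x∉xs ∷ u) {Fin.suc i} {Fin.suc j} e = cong Fin.suc (lookup-injective u e)

pick : ∀ (q : A → Bool) {xs m} → Unique xs → m ≤ count q xs →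
       Σ[ f ∈ (Fin m → A) ] Injective _≡_ _≡_ f × (∀ i → T (q (f i)))
pick q {xs} u m≤ = f , (λ e → inject≤-injective m≤ m≤ _ _ (lookup-injective (filter⁺ q? u) e)) , q∘f
  where
    q? = λ x → T? (q x)
    f = λ i → lookup (filter q? xs) (inject≤ i m≤)
    q∘f : ∀ i → T (q (f i))
    q∘f i = proj₂ (∈-filter⁻ q? {xs = xs} (∈-lookup (inject≤ i m≤)))

record Selection (p : A → Bool) (ys : List A) (m : ℕ) : Set where
  field
    element   : Fin m → A
    injective : Injective _≡_ _≡_ element
    satisfies : ∀ i → p (element i) ≡ true
    avoids    : ∀ i → element i ∉ ys

module _ {A : Set} (_≟_ : DecidableEquality A) where

  open import Data.List.Membership.DecPropositional _≟_ using (_∈?_; _∉?_)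

  count-≟ : ∀ {xs} → Unique xs → ∀ y → count (λ x → does (x ≟ y)) xs ≤ 1
  count-≟ []             y = z≤n
  count-≟ {x ∷ _} (x∉xs ∷ u) y with x ≟ y
  ... | no _     = count-≟ u y
  ... | yes refl = s≤s (≤-reflexive (count-none (All.map ≢x⇒¬[≟x] x∉xs)))
    where
      ≢x⇒¬[≟x] : ∀ {z} → x ≢ z → ¬ T (does (z ≟ x))
      ≢x⇒¬[≟x] {z} x≢z = subst T (dec-false (z ≟ x) (≢-sym x≢z))

  count-∈ : ∀ {xs} → Unique xs → ∀ ys → count (λ x → does (x ∈? ys)) xs ≤ length ys
  count-∈ {xs} u []       = ≤-reflexive (count-false xs)
  count-∈ {xs} u (y ∷ ys) =
    ≤-trans (count-∨ (λ x → does (x ≟ y)) (λ x → does (x ∈? ys)) xs) (+-mono-≤ (count-≟ u y) (count-∈ u ys))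

  select : ∀ {xs} → Unique xs → (p : A → Bool) (ys : List A) {m : ℕ} →
           m + length ys ≤ count p xs → Selection p ys m
  select {xs} u p ys {m} m+ys≤ = record
    { element   = f
    ; injective = f-injective
    ; satisfies = λ i → to T-≡ (proj₁ (to T-∧ (q∘f i)))
    ; avoids    = λ i fi∈ys → subst T (cong not (dec-true (f i ∈? ys) fi∈ys)) (proj₂ (to T-∧ (q∘f i)))
    }
    where
      q : A → Bool
      q x = p x ∧ does (x ∉? ys)
      m≤ : m ≤ count q xs
      m≤ = +-cancelʳ-≤ (length ys) m (count q xs) (begin
        m + length ys                                      ≤⟨ m+ys≤ ⟩
        count p xs                                         ≤⟨ count-split p (λ x → does (x ∈? ys)) xs ⟩
        count q xs + count (λ x → does (x ∈? ys)) xs       ≤⟨ +-monoʳ-≤ (count q xs) (count-∈ u ys) ⟩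
        count q xs + length ys                             ∎)
        where open ≤-Reasoning
      picked = pick q u m≤
      f = proj₁ picked
      f-injective = proj₁ (proj₂ picked)
      q∘f = proj₂ (proj₂ picked)

module _ {N : ℕ} (G : Graph N) where

  adj⇒≢ : ∀ {x y} → adj G x y ≡ true → x ≢ y
  adj⇒≢ {x} xy refl with () ← trans (sym xy) (irrefl G x)

  adj-sym : ∀ {x y} → adj G x y ≡ true → adj G y x ≡ true
  adj-sym {x} {y} xy = trans (Graph.sym G y x) xy

  neighbour : ∀ {v} → 0 < deg G v → Σ[ w ∈ Fin N ] adj G v w ≡ true
  neighbour {v} 0<d =
    let (f , _ , adj-f) = pick (adj G v) (allFin⁺ N) 0<d in f Fin.zero , to T-≡ (adj-f Fin.zero)

  NeighboursIn : (Fin N → Bool) → (Fin N → Bool) → Set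
  NeighboursIn A B = ∀ u w → A u ≡ true → adj G u w ≡ true → B w ≡ true

  EdgeLeaving : (Fin N → Bool) → (Fin N → Bool) → Set
  EdgeLeaving A B = Σ[ u ∈ Fin N ] Σ[ w ∈ Fin N ] A u ≡ true × adj G u w ≡ true × B w ≡ false

  neighboursIn⊎edgeLeaving : ∀ A B → NeighboursIn A B ⊎ EdgeLeaving A B
  neighboursIn⊎edgeLeaving A B
    with any? (λ u → any? (λ w → (A u ≟ᵇ true) ×-dec (adj G u w ≟ᵇ true) ×-dec (B w ≟ᵇ false)))
  ... | yes edge = inj₂ edge
  ... | no none  = inj₁ λ u w Au uw → ¬-not (λ Bw → none (u , w , Au , uw , Bw))

  sumDeg≡eBetween : ∀ A B → NeighboursIn A B →
                    sum (map (deg G) (filter (λ v → T? (A v)) (allFin N))) ≡ eBetween G A B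
  sumDeg≡eBetween A B A→B = begin
    sum (map (deg G) (filter (λ v → T? (A v)) (allFin N)))      ≡⟨ sum-map-filter A (deg G) (allFin N) ⟩
    sum (map (λ u → if A u then deg G u else 0) (allFin N))     ≡⟨ cong sum (map-cong row (allFin N)) ⟨
    sum (map (λ u → count (edge ∘ (u ,_)) (allFin N)) (allFin N))
      ≡⟨ cong sum (map-cong (λ u → count-map edge (u ,_) (allFin N)) (allFin N)) ⟨
    sum (map (λ u → count edge (map (u ,_) (allFin N))) (allFin N))
      ≡⟨ count-concatMap edge (λ u → map (u ,_) (allFin N)) (allFin N) ⟨
    eBetween G A B                                             ∎
    where
      open ≡-Reasoning
      edge : Fin N × Fin N → Bool
      edge (u , w) = A u ∧ B w ∧ adj G u w
      row : ∀ u → count (edge ∘ (u ,_)) (allFin N) ≡ (if A u then deg G u else 0)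
      row u with A u in Au
      ... | false = count-false (allFin N)
      ... | true  = count-cong B∧adj≗adj (allFin N)
        where
          B∧adj≗adj : ∀ w → B w ∧ adj G u w ≡ adj G u w
          B∧adj≗adj w with adj G u w in uw
          ... | false = ∧-zeroʳ (B w)
          ... | true  = cong (_∧ true) (A→B u w Au uw)

  edge⇒containsDoubleStar : ∀ {a b k l} → adj G a b ≡ true → l < deg G b → k + l < deg G a →
                            ContainsDoubleStar G k l
  edge⇒containsDoubleStar {a} {b} {k} {l} ab l<db k+l<da = embed , embed-injective , embed-edge
    where
      open ≤-Reasoning
      module L₂ = Selection (select _≟ᶠ_ (allFin⁺ N) (adj G b) (a ∷ []) (begin
        l + 1      ≡⟨ +-comm l 1 ⟩
        suc l      ≤⟨ l<db ⟩
        deg G b    ∎))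
      module L₁ = Selection (select _≟ᶠ_ (allFin⁺ N) (adj G a) (b ∷ tabulate L₂.element) (begin
        k + length (b ∷ tabulate L₂.element) ≡⟨ cong (λ t → k + suc t) (length-tabulate L₂.element) ⟩
        k + suc l                            ≡⟨ +-suc k l ⟩
        suc (k + l)                          ≤⟨ k+l<da ⟩
        deg G a                              ∎))

      a≢b : a ≢ b
      a≢b = adj⇒≢ ab
      a≢leaf₁ : ∀ i → a ≢ L₁.element i
      a≢leaf₁ i = adj⇒≢ (L₁.satisfies i)
      b≢leaf₂ : ∀ j → b ≢ L₂.element j
      b≢leaf₂ j = adj⇒≢ (L₂.satisfies j)
      leaf₂≢a : ∀ j → L₂.element j ≢ a
      leaf₂≢a j e = L₂.avoids j (here e)
      leaf₁≢b : ∀ i → L₁.element i ≢ b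
      leaf₁≢b i e = L₁.avoids i (here e)
      leaf₁≢leaf₂ : ∀ i j → L₁.element i ≢ L₂.element j
      leaf₁≢leaf₂ i j e = L₁.avoids i (there (subst (_∈ tabulate L₂.element) (sym e) (∈-tabulate⁺ j)))

      embed : DSVertex k l → Fin N
      embed centre₁   = a
      embed centre₂   = b
      embed (leaf₁ i) = L₁.element i
      embed (leaf₂ j) = L₂.element j

      embed-injective : Injective _≡_ _≡_ embed
      embed-injective {centre₁}  {centre₁}   e = refl
      embed-injective {centre₁}  {centre₂}   e = contradiction e a≢b
      embed-injective {centre₁}  {leaf₁ i}   e = contradiction e (a≢leaf₁ i)
      embed-injective {centre₁}  {leaf₂ j}   e = contradiction (sym e) (leaf₂≢a j)
      embed-injective {centre₂}  {centre₁}   e = contradiction (sym e) a≢b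
      embed-injective {centre₂}  {centre₂}   e = refl
      embed-injective {centre₂}  {leaf₁ i}   e = contradiction (sym e) (leaf₁≢b i)
      embed-injective {centre₂}  {leaf₂ j}   e = contradiction e (b≢leaf₂ j)
      embed-injective {leaf₁ i}  {centre₁}   e = contradiction (sym e) (a≢leaf₁ i)
      embed-injective {leaf₁ i}  {centre₂}   e = contradiction e (leaf₁≢b i)
      embed-injective {leaf₁ i}  {leaf₁ i′}  e = cong leaf₁ (L₁.injective e)
      embed-injective {leaf₁ i}  {leaf₂ j}   e = contradiction e (leaf₁≢leaf₂ i j)
      embed-injective {leaf₂ j}  {centre₁}   e = contradiction e (leaf₂≢a j)
      embed-injective {leaf₂ j}  {centre₂}   e = contradiction (sym e) (b≢leaf₂ j)
      embed-injective {leaf₂ j}  {leaf₁ i}   e = contradiction (sym e) (leaf₁≢leaf₂ i j)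
      embed-injective {leaf₂ j}  {leaf₂ j′}  e = cong leaf₂ (L₂.injective e)

      embed-edge : ∀ x y → DSEdge x y → adj G (embed x) (embed y) ≡ true
      embed-edge _ _ cc      = ab
      embed-edge _ _ cc'     = adj-sym ab
      embed-edge _ _ (c₁l i) = L₁.satisfies i
      embed-edge _ _ (lc₁ i) = adj-sym (L₁.satisfies i)
      embed-edge _ _ (c₂l j) = L₂.satisfies j
      embed-edge _ _ (lc₂ j) = adj-sym (L₂.satisfies j)

  containsDoubleStar-swap : ∀ {k l} → ContainsDoubleStar G l k → ContainsDoubleStar G k l
  containsDoubleStar-swap (f , f-injective , f-edge) =
    f ∘ swap , (λ e → swap-injective (f-injective e)) , (λ x y xy → f-edge _ _ (swap-edge xy))
    where
      swap : ∀ {k l} → DSVertex k l → DSVertex l k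
      swap centre₁   = centre₂
      swap centre₂   = centre₁
      swap (leaf₁ i) = leaf₂ i
      swap (leaf₂ j) = leaf₁ j

      swap-involutive : ∀ {k l} (x : DSVertex k l) → swap (swap x) ≡ x
      swap-involutive centre₁   = refl
      swap-involutive centre₂   = refl
      swap-involutive (leaf₁ i) = refl
      swap-involutive (leaf₂ j) = refl

      swap-injective : ∀ {k l} {x y : DSVertex k l} → swap x ≡ swap y → x ≡ y
      swap-injective {x = x} {y} e =
        trans (sym (swap-involutive x)) (trans (cong swap e) (swap-involutive y))

      swap-edge : ∀ {k l} {x y : DSVertex k l} → DSEdge x y → DSEdge (swap x) (swap y)
      swap-edge cc      = cc'
      swap-edge cc'     = cc
      swap-edge (c₁l i) = c₂l i
      swap-edge (lc₁ i) = lc₂ i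
      swap-edge (c₂l j) = c₁l j
      swap-edge (lc₂ j) = lc₁ j

m+n≡2*o⇒m≤o⊎n≤o : ∀ {m n o} → m + n ≡ 2 * o → m ≤ o ⊎ n ≤ o
m+n≡2*o⇒m≤o⊎n≤o {m} {n} {o} m+n≡2o with ≤-total m o
... | inj₁ m≤o = inj₁ m≤o
... | inj₂ o≤m = inj₂ (+-cancelˡ-≤ o n o (begin
  o + n          ≤⟨ +-monoˡ-≤ n o≤m ⟩
  m + n          ≡⟨ m+n≡2o ⟩
  2 * o          ≡⟨ cong (o +_) (+-identityʳ o) ⟩
  o + o          ∎))
  where open ≤-Reasoning

edge⇒containsAllDoubleStars : ∀ {N} (G : Graph N) {n a b} → adj G a b ≡ true →
                              2 * n < deg G a → n < deg G b → ContainsAllDoubleStars G n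
edge⇒containsAllDoubleStars G {n} {a} ab 2n<da n<db k l _ _ k+l+2≡2n+2 =
  doubleStar (+-cancelʳ-≡ 2 (k + l) (2 * n) k+l+2≡2n+2)
  where
    doubleStar : k + l ≡ 2 * n → ContainsDoubleStar G k l
    doubleStar k+l≡2n with m+n≡2*o⇒m≤o⊎n≤o k+l≡2n
    ... | inj₂ l≤n = edge⇒containsDoubleStar G ab (≤-<-trans l≤n n<db)
                       (subst (_< deg G a) (sym k+l≡2n) 2n<da)
    ... | inj₁ k≤n = containsDoubleStar-swap G (edge⇒containsDoubleStar G ab (≤-<-trans k≤n n<db)
                       (subst (_< deg G a) (sym (trans (+-comm l k) k+l≡2n)) 2n<da))

≤ᵇ≡true⇒≤ : ∀ {m n} → (m ≤ᵇ n) ≡ true → m ≤ n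
≤ᵇ≡true⇒≤ {m} {n} m≤ᵇn = ≤ᵇ⇒≤ m n (subst T (sym m≤ᵇn) _)

≤ᵇ≡false⇒> : ∀ {m n} → (m ≤ᵇ n) ≡ false → n < m
≤ᵇ≡false⇒> m≰ᵇn = ≰⇒> (λ m≤n → subst T m≰ᵇn (≤⇒≤ᵇ m≤n))

mainTheorem4 : (n N : ℕ) → 1 ≤ n → 2 * n + 2 ≤ N → (G : Graph N) →
    Σ (Fin N) (λ v → inL n G v ≡ true) →
    ContainsAllDoubleStars G n
    ⊎ (sumDegL n G ≡ eBetween G (inL n G) (inS n G)
       × Σ (Fin N) (λ v → inS n G v ≡ true))
mainTheorem4 n N _ _ G (v , v∈L) with neighboursIn⊎edgeLeaving G (inL n G) (inS n G)
... | inj₂ (u , w , u∈L , uw , w∉S) =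
  inj₁ (edge⇒containsAllDoubleStars G uw (≤ᵇ≡true⇒≤ u∈L) (≤ᵇ≡false⇒> w∉S))
... | inj₁ L→S =
  let (w , vw) = neighbour G (≤-trans (s≤s z≤n) (≤ᵇ≡true⇒≤ v∈L))
  in inj₂ (sumDeg≡eBetween G (inL n G) (inS n G) L→S , w , L→S v w v∈L vw)
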